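{- Let $p\ge2$ be an integer and let $G$ be a graph with $\operatorname{girth}(G)\ge 2p-1$. Then $G$ is $p$-path degenerate if and only if $G$ contains no subgraph $H$ that is a $\le(p-2)$-subdivision of a simple graph with minimum degree at least $3$.
   Context: A $\le k$-subdivision of a graph $F$ is obtained by replacing each edge of $F$ by a path of length at most $k+1$ (i.e. subdividing each edge at most $k$ times), the paths being internally disjoint. Forests have girth $+\infty$. A strict ear of $G$ is a path with distinct endpoints whose internal vertices have degree $2$ in $G$. A $p$-reduction deletes an isolated vertex, a vertex of degree $1$, or the internal vertices of a strict ear of length at least $p$; $G$ is $p$-path degenerate if it can be reduced to the empty graph by a sequence of $p$-reductions. -}

module Defs where

open import Data.Nat using (ℕ; zero; suc; _+_; _≤_; _<_)
open import Data.Bool using (Bool; true; false)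
open import Data.Fin using (Fin) renaming (_<_ to _<ᶠ_)
open import Data.Fin.Subset using (Subset; _∈_; _∉_; _∩_; _-_; ∣_∣; ⊥; ⊤)
open import Data.Vec using (tabulate)
open import Data.List using (List; []; _∷_; _++_; [_]; length; foldl)
open import Data.List.Relation.Unary.All using (All)
open import Data.List.Relation.Unary.Unique.Propositional using (Unique)
open import Data.List.Membership.Propositional renaming (_∈_ to _∈ˡ_)
open import Data.Product using (Σ; _×_; _,_; ∃)
open import Relation.Binary.PropositionalEquality using (_≡_; _≢_)
open import Relation.Nullary using (¬_)

record Graph (n : ℕ) : Set where
  field
    adj    : Fin n → Fin n → Bool
    sym    : ∀ u v → adj u v ≡ adj v u
    irrefl : ∀ v → adj v v ≡ false
open Graph public

Adj : ∀ {n} → Graph n → Fin n → Fin n → Set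
Adj G u v = adj G u v ≡ true

nbr : ∀ {n} → Graph n → Fin n → Subset n
nbr G v = tabulate (adj G v)

degIn : ∀ {n} → Graph n → Subset n → Fin n → ℕ
degIn G S v = ∣ S ∩ nbr G v ∣

deg : ∀ {n} → Graph n → Fin n → ℕ
deg G v = degIn G ⊤ v

data Walk {n} (G : Graph n) : List (Fin n) → Set where
  w[]  : Walk G []
  w[-] : ∀ x → Walk G (x ∷ [])
  w∷   : ∀ {x y xs} → Adj G x y → Walk G (y ∷ xs) → Walk G (x ∷ y ∷ xs)

IsCycle : ∀ {n} → Graph n → Fin n → List (Fin n) → Set
IsCycle G x xs = (2 ≤ length xs) × Unique (x ∷ xs) × Walk G (x ∷ xs ++ [ x ])

-- girth(G) ≥ g : every cycle has length ≥ g (forests have girth +∞)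
GirthAtLeast : ∀ {n} → Graph n → ℕ → Set
GirthAtLeast G g = ∀ x xs → IsCycle G x xs → g ≤ suc (length xs)

removeAll : ∀ {n} → Subset n → List (Fin n) → Subset n
removeAll S ys = foldl _-_ S ys

StrictEar : ∀ {n} → Graph n → Subset n → Fin n → List (Fin n) → Fin n → Set
StrictEar G S a ys b =
  (a ∈ S) × (b ∈ S) × All (_∈ S) ys ×
  Unique (a ∷ ys ++ [ b ]) × Walk G (a ∷ ys ++ [ b ]) ×
  All (λ y → degIn G S y ≡ 2) ys

data Reduction {n} (p : ℕ) (G : Graph n) (S : Subset n) : Subset n → Set where
  delIsolated : ∀ v → v ∈ S → degIn G S v ≡ 0 → Reduction p G S (S - v)
  delLeaf     : ∀ v → v ∈ S → degIn G S v ≡ 1 → Reduction p G S (S - v)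
  delEar      : ∀ a ys b → StrictEar G S a ys b → p ≤ suc (length ys) →
                Reduction p G S (removeAll S ys)

data Reducible {n} (p : ℕ) (G : Graph n) : Subset n → Set where
  done : Reducible p G ⊥
  step : ∀ {S S'} → Reduction p G S S' → Reducible p G S' → Reducible p G S

PathDegenerate : ∀ {n} → ℕ → Graph n → Set
PathDegenerate p G = Reducible p G ⊤

record SubdivisionIn {m n} (k : ℕ) (F : Graph m) (G : Graph n) : Set where
  field
    φ      : Fin m → Fin n
    φ-inj  : ∀ u v → φ u ≡ φ v → u ≡ v
    int    : Fin m → Fin m → List (Fin n)
    short  : ∀ u v → u <ᶠ v → Adj F u v → length (int u v) ≤ k
    path   : ∀ u v → u <ᶠ v → Adj F u v → Walk G (φ u ∷ int u v ++ [ φ v ])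
    uniq   : ∀ u v → u <ᶠ v → Adj F u v → Unique (int u v)
    avoid  : ∀ u v → u <ᶠ v → Adj F u v → ∀ x → x ∈ˡ int u v → ∀ w → φ w ≢ x
    disj   : ∀ u v u' v' → u <ᶠ v → Adj F u v → u' <ᶠ v' → Adj F u' v' →
             (u , v) ≢ (u' , v') → ∀ x → x ∈ˡ int u v → ¬ (x ∈ˡ int u' v')

ContainsSubdivMinDeg3 : ∀ {n} → ℕ → Graph n → Set
ContainsSubdivMinDeg3 {n} k G =
  Σ ℕ λ m → Σ (Graph m) λ F → (1 ≤ m) × (∀ v → 3 ≤ deg F v) × SubdivisionIn k F G

-- (⇒) Let H be a ≤(p−2)-subdivision of a graph of minimum degree 3. In every induced
-- subgraph G[S] that still contains H, a branch vertex of H has degree ≥ 3 and an interior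
-- vertex of an H-path has degree ≥ 2, so neither is deleted as an isolated vertex or a leaf.
-- The interior vertices of a strict ear have degree 2; if the ear met the interior of an H-path
-- it could only run along that path, so it would have at most p−2 interior vertices, too few for
-- a p-reduction. Hence H survives every p-reduction and the graph never becomes empty.
--
-- (⇐) Reduce G[S] greedily. If no vertex has degree ≤ 1, follow the vertices of degree 2 from each
-- vertex a through each neighbour x. Since the girth is at least 2p−1 this walk cannot close up
-- within p steps, so it either passes p−1 vertices of degree 2, giving an ear that a p-reduction
-- deletes, or stops after at most p−2 of them at a vertex of degree ≥ 3. In the latter case for
-- all a and x, the vertices of degree ≥ 3 together with these threads form a ≤(p−2)-subdivision
-- of a graph F. Threads leaving a through distinct neighbours end at distinct vertices, as
-- otherwise they would close a cycle of length ≤ 2p−2; thus F has minimum degree 3.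

module Submission where

open import Defs
open import Data.Bool using (Bool; true; _∨_)
open import Data.Bool.Properties using (∨-comm)
open import Data.Empty using (⊥-elim)
open import Data.Fin using (Fin; zero; suc; _≟_) renaming (_<_ to _<ᶠ_)
import Data.Fin.Properties as Fin
open import Data.Fin.Subset using (Subset; _∈_; _∉_; _∩_; _-_; ∣_∣; ⊤; Nonempty; outside; inside)
open import Data.Fin.Subset.Properties
  using (_∈?_; ∈⊤; ∉⊥; x∈p∩q⁺; x∈p∩q⁻; x∈p∧x≢y⇒x∈p-y; x∈p⇒∣p-x∣<∣p∣; nonempty?; Empty-unique; ∣⊥∣≡0; ∣p∣≤n;
         p─⊥≡p; p─q⊆p; ∣p─q∣≤∣p∣)
open import Data.List using (List; []; _∷_; _++_; [_]; length; reverse; lookup; filter; allFin)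
open import Data.List.Membership.Propositional using () renaming (_∈_ to _∈ˡ_; _∉_ to _∉ˡ_)
open import Data.List.Membership.Propositional.Properties
  using (∈-++⁻; ∈-++⁺ˡ; ∈-++⁺ʳ; ∈-∃++; ∉[]; ∈-lookup; ∈-filter⁺; ∈-filter⁻; ∈-allFin)
import Data.List.Membership.DecPropositional as DecMembership
open import Data.List.Properties using (++-assoc; unfold-reverse; reverse-++; length-++; length-reverse)
open import Data.List.Relation.Unary.All as All using (All; []; _∷_)
import Data.List.Relation.Unary.All.Properties as All
open import Data.List.Relation.Unary.AllPairs using ([]; _∷_)
open import Data.List.Relation.Unary.Any as Any using (here; there)
import Data.List.Relation.Unary.Any.Properties as Any
open import Data.List.Relation.Unary.First as First using (first)
open import Data.List.Relation.Unary.First.Properties using (toView)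
open import Data.List.Relation.Unary.Unique.Propositional using (Unique)
import Data.List.Relation.Unary.Unique.Propositional.Properties as Unique
open import Data.Nat using (ℕ; zero; suc; _+_; _*_; _∸_; _≤_; _<_; z≤n; s≤s)
import Data.Nat as ℕ
open import Data.Nat.Properties
  using (≤-refl; ≤-reflexive; ≤-trans; ≤-pred; n≤1+n; <⇒≱; ≰⇒>; ≤∧≢⇒<; <-irrefl; m≤n+m; m≤m+n; m≤n+m∸n;
         +-mono-≤; +-monoˡ-≤; +-suc; +-comm; +-identityʳ)
open import Data.Product using (Σ; ∃; ∃₂; _×_; _,_; proj₁; proj₂)
open import Data.Sum as Sum using (_⊎_; inj₁; inj₂; map₁; map₂; swap)
import Data.Vec as Vec
open import Data.Vec using (tabulate)
open import Data.Vec.Properties using (lookup∘tabulate; []=⇒lookup; lookup⇒[]=)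
open import Function using (_∘_)
open import Function.Bundles using (_⇔_; mk⇔)
open import Relation.Binary.Definitions using (tri<; tri≈; tri>)
open import Relation.Binary.PropositionalEquality as ≡ using (_≡_; _≢_; refl; trans; cong; cong₂; subst)
open import Relation.Nullary using (¬_; ¬?; Dec; yes; no; does; _×-dec_)
open import Relation.Nullary.Decidable using (dec-true; dec-false; toSum)

private variable
  n : ℕ
  T : Set
  x : T
  xs ys : List T

_∈ˡ?_ : ∀ (x : Fin n) xs → Dec (x ∈ˡ xs)
x ∈ˡ? xs = DecMembership._∈?_ _≟_ x xs

Unique-++⁻ˡ : ∀ (xs : List T) → Unique (xs ++ ys) → Unique xs
Unique-++⁻ˡ []       _                 = []
Unique-++⁻ˡ (x ∷ xs) (x∉xs++ys ∷ uniq) = All.++⁻ˡ xs x∉xs++ys ∷ Unique-++⁻ˡ xs uniq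

Unique-++⁻ʳ : ∀ (xs : List T) → Unique (xs ++ ys) → Unique ys
Unique-++⁻ʳ []       uniq       = uniq
Unique-++⁻ʳ (x ∷ xs) (_ ∷ uniq) = Unique-++⁻ʳ xs uniq

Unique-++⇒disjoint : ∀ (xs : List T) → Unique (xs ++ ys) → x ∈ˡ xs → x ∉ˡ ys
Unique-++⇒disjoint (x ∷ xs) (x∉ ∷ _)    (here refl) = All.All¬⇒¬Any (All.++⁻ʳ xs x∉)
Unique-++⇒disjoint (x ∷ xs) (_ ∷ uniq) (there x∈)  = Unique-++⇒disjoint xs uniq x∈

Unique-prefix : ∀ (xs : List T) {z ys} → Unique (xs ++ z ∷ ys) → Unique (xs ++ [ z ])
Unique-prefix xs {z} {ys} uniq = Unique-++⁻ˡ (xs ++ [ z ]) (subst Unique (≡.sym (++-assoc xs [ z ] ys)) uniq)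

1+length≤length-++-∷ : ∀ (xs : List T) {z ys} → suc (length xs) ≤ length (xs ++ z ∷ ys)
1+length≤length-++-∷ []       = s≤s z≤n
1+length≤length-++-∷ (x ∷ xs) = s≤s (1+length≤length-++-∷ xs)

length-∷ʳ : ∀ (xs : List T) {x} → length (xs ++ [ x ]) ≡ suc (length xs)
length-∷ʳ xs = trans (length-++ xs) (+-comm (length xs) 1)

length-++-∷-reverse : ∀ (P : List T) {z} Q → length (P ++ z ∷ reverse Q) ≡ length P + suc (length Q)
length-++-∷-reverse P Q = trans (length-++ P) (cong (λ k → length P + suc k) (length-reverse Q))

Unique-∷ʳ⁺ : Unique xs → x ∉ˡ xs → Unique (xs ++ [ x ])
Unique-∷ʳ⁺ uniq x∉ = Unique.++⁺ uniq ([] ∷ []) λ { (x∈ , here refl) → x∉ x∈ }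

Unique-reverse⁺ : Unique xs → Unique (reverse xs)
Unique-reverse⁺ {xs = []}     _          = []
Unique-reverse⁺ {xs = x ∷ xs} (x∉ ∷ uniq) rewrite unfold-reverse x xs =
  Unique-∷ʳ⁺ (Unique-reverse⁺ uniq) (All.All¬⇒¬Any x∉ ∘ Any.reverse⁻)

All-reverse⁺ : {P : T → Set} → All P xs → All P (reverse xs)
All-reverse⁺ pxs = All.tabulate (All.lookup pxs ∘ Any.reverse⁻)

reverse-path : ∀ (a : T) I b → reverse (a ∷ I ++ [ b ]) ≡ b ∷ reverse I ++ [ a ]
reverse-path a I b = trans (unfold-reverse a (I ++ [ b ])) (cong (_++ [ a ]) (reverse-++ I [ b ]))

∷-∃∷ʳ : ∀ (a : T) xs → ∃₂ λ B q → a ∷ xs ≡ B ++ [ q ]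
∷-∃∷ʳ a []       = [] , a , refl
∷-∃∷ʳ a (x ∷ xs) with ∷-∃∷ʳ x xs
... | B , q , eq = a ∷ B , q , cong (a ∷_) eq

split-around : ∀ (a : T) I b {w} → w ∈ˡ I →
               ∃₂ λ B q → ∃₂ λ r C → a ∷ I ++ [ b ] ≡ B ++ q ∷ w ∷ r ∷ C
split-around a I b {w} w∈I with ∈-∃++ w∈I | ∷-∃∷ʳ a (proj₁ (∈-∃++ w∈I))
... | I₁ , I₂ , refl | B , q , a∷I₁≡B∷ʳq with succ I₂
  where
  succ : ∀ I₂ → ∃₂ λ r C → I₂ ++ [ b ] ≡ r ∷ C
  succ []        = b , [] , refl
  succ (r ∷ I₂′) = r , I₂′ ++ [ b ] , refl
... | r , C , I₂∷ʳb≡r∷C = B , q , r , C , (begin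
  a ∷ (I₁ ++ w ∷ I₂) ++ [ b ]  ≡⟨ cong (a ∷_) (++-assoc I₁ (w ∷ I₂) [ b ]) ⟩
  (a ∷ I₁) ++ w ∷ I₂ ++ [ b ]  ≡⟨ cong₂ (λ X Y → X ++ w ∷ Y) a∷I₁≡B∷ʳq I₂∷ʳb≡r∷C ⟩
  (B ++ [ q ]) ++ w ∷ r ∷ C    ≡⟨ ++-assoc B [ q ] (w ∷ r ∷ C) ⟩
  B ++ q ∷ w ∷ r ∷ C           ∎)
  where open ≡.≡-Reasoning

first-shared : ∀ (P Q : List (Fin n)) {e} → e ∈ˡ P → e ∈ˡ Q →
               ∃₂ λ P₁ z → ∃ λ P₂ → P ≡ P₁ ++ z ∷ P₂ × z ∈ˡ Q × All (_∉ˡ Q) P₁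
first-shared P Q e∈P e∈Q with first (λ x → swap (toSum (x ∈ˡ? Q))) P
... | inj₁ f with toView f
...   | First._++_∷_ P₁∉Q z∈Q P₂ = _ , _ , P₂ , refl , z∈Q , P₁∉Q
first-shared P Q e∈P e∈Q | inj₂ P∉Q = ⊥-elim (All.lookup P∉Q e∈P e∈Q)

Unique⇒lookup-injective : ∀ {xs : List T} → Unique xs → ∀ i j → lookup xs i ≡ lookup xs j → i ≡ j
Unique⇒lookup-injective (_ ∷ _)  zero    zero    _  = refl
Unique⇒lookup-injective (x∉ ∷ _) zero    (suc j) eq = ⊥-elim (All.lookup x∉ (∈-lookup j) eq)
Unique⇒lookup-injective (x∉ ∷ _) (suc i) zero    eq = ⊥-elim (All.lookup x∉ (∈-lookup i) (≡.sym eq))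
Unique⇒lookup-injective (_ ∷ u)  (suc i) (suc j) eq = cong suc (Unique⇒lookup-injective u i j eq)

some⊎all : {A B : Fin n → Set} → (∀ i → A i ⊎ B i) → Σ (Fin n) A ⊎ (∀ i → B i)
some⊎all {zero} f = inj₂ λ ()
some⊎all {suc n} {A} {B} f with f zero | some⊎all {A = A ∘ suc} {B ∘ suc} (f ∘ suc)
... | inj₁ a | _            = inj₁ (zero , a)
... | inj₂ _ | inj₁ (i , a) = inj₁ (suc i , a)
... | inj₂ b | inj₂ g       = inj₂ λ { zero → b ; (suc i) → g i }

same-ends⇒same-pair : ∀ {i j i′ j′ : Fin n} → i <ᶠ j → i′ <ᶠ j′ →
                      i ≡ i′ ⊎ i ≡ j′ → j ≡ i′ ⊎ j ≡ j′ → (i , j) ≡ (i′ , j′)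
same-ends⇒same-pair i<j _     (inj₁ refl) (inj₁ refl) = ⊥-elim (Fin.<-irrefl refl i<j)
same-ends⇒same-pair _   _     (inj₁ refl) (inj₂ refl) = refl
same-ends⇒same-pair i<j i′<j′ (inj₂ refl) (inj₁ refl) = ⊥-elim (Fin.<-asym i<j i′<j′)
same-ends⇒same-pair i<j _     (inj₂ refl) (inj₂ refl) = ⊥-elim (Fin.<-irrefl refl i<j)

∈-tabulate⁺ : {f : Fin n → Bool} {x : Fin n} → f x ≡ true → x ∈ tabulate f
∈-tabulate⁺ {f = f} {x} fx = lookup⇒[]= x _ (trans (lookup∘tabulate f x) fx)

∈-tabulate⁻ : {f : Fin n → Bool} {x : Fin n} → x ∈ tabulate f → f x ≡ true
∈-tabulate⁻ {f = f} {x} x∈ = trans (≡.sym (lookup∘tabulate f x)) ([]=⇒lookup x∈)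

x∉p-x : ∀ (p : Subset n) x → x ∉ p - x
x∉p-x (_ Vec.∷ p) (suc x) (Vec.there x∈) = x∉p-x p x x∈

∣p∣≤1+∣p-x∣ : ∀ (p : Subset n) x → ∣ p ∣ ≤ suc ∣ p - x ∣
∣p∣≤1+∣p-x∣ (inside  Vec.∷ p) zero    = ≤-reflexive (cong (suc ∘ ∣_∣) (≡.sym (p─⊥≡p p)))
∣p∣≤1+∣p-x∣ (outside Vec.∷ p) zero    = ≤-trans (≤-reflexive (cong ∣_∣ (≡.sym (p─⊥≡p p)))) (n≤1+n _)
∣p∣≤1+∣p-x∣ (inside  Vec.∷ p) (suc x) = s≤s (∣p∣≤1+∣p-x∣ p x)
∣p∣≤1+∣p-x∣ (outside Vec.∷ p) (suc x) = ∣p∣≤1+∣p-x∣ p x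

⊆⇒∣p∣≤length : ∀ (p : Subset n) xs → (∀ {y} → y ∈ p → y ∈ˡ xs) → ∣ p ∣ ≤ length xs
⊆⇒∣p∣≤length {n} p [] p⊆[] with Empty-unique {p = p} (λ (_ , y∈p) → ∉[] (p⊆[] y∈p))
... | refl = ≤-reflexive (∣⊥∣≡0 n)
⊆⇒∣p∣≤length p (x ∷ xs) p⊆x∷xs = ≤-trans (∣p∣≤1+∣p-x∣ p x) (s≤s (⊆⇒∣p∣≤length (p - x) xs p-x⊆xs))
  where
  p-x⊆xs : ∀ {y} → y ∈ p - x → y ∈ˡ xs
  p-x⊆xs {y} y∈ with p⊆x∷xs (p─q⊆p p _ y∈)
  ... | here refl = ⊥-elim (x∉p-x p x y∈)
  ... | there y∈xs = y∈xs

Unique⇒length≤∣p∣ : ∀ {p : Subset n} {xs} → Unique xs → All (_∈ p) xs → length xs ≤ ∣ p ∣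
Unique⇒length≤∣p∣ [] [] = z≤n
Unique⇒length≤∣p∣ {p = p} {x ∷ xs} (x∉xs ∷ u) (x∈p ∷ xs⊆p) =
  ≤-trans (s≤s (Unique⇒length≤∣p∣ u (All.zipWith (λ (x≢y , y∈p) → x∈p∧x≢y⇒x∈p-y y∈p (x≢y ∘ ≡.sym)) (x∉xs , xs⊆p))))
          (x∈p⇒∣p-x∣<∣p∣ x∈p)

length<∣p∣⇒∃∉ : ∀ (p : Subset n) xs → length xs < ∣ p ∣ → ∃ λ y → y ∈ p × y ∉ˡ xs
length<∣p∣⇒∃∉ p xs xs<p with some⊎all {A = λ y → y ∈ p × y ∉ˡ xs} {B = λ y → y ∈ p → y ∈ˡ xs} decide
  where
  decide : ∀ y → (y ∈ p × y ∉ˡ xs) ⊎ (y ∈ p → y ∈ˡ xs)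
  decide y with y ∈? p | y ∈ˡ? xs
  ... | yes y∈p | no y∉xs = inj₁ (y∈p , y∉xs)
  ... | _       | yes y∈xs = inj₂ λ _ → y∈xs
  ... | no y∉p  | _        = inj₂ λ y∈p → ⊥-elim (y∉p y∈p)
... | inj₁ (y , r) = y , r
... | inj₂ p⊆xs = ⊥-elim (<⇒≱ xs<p (⊆⇒∣p∣≤length p xs (p⊆xs _)))

2≤∣p∣⇒∃≢ : ∀ (p : Subset n) x → 2 ≤ ∣ p ∣ → ∃ λ y → y ∈ p × y ≢ x
2≤∣p∣⇒∃≢ p x 2≤p with length<∣p∣⇒∃∉ p [ x ] 2≤p
... | y , y∈p , y∉[x] = y , y∈p , λ y≡x → y∉[x] (here y≡x)

3≤∣p∣⇒∃-three-distinct : ∀ (p : Subset n) → 3 ≤ ∣ p ∣ →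
                   ∃ λ a → ∃ λ b → ∃ λ c → a ∈ p × b ∈ p × c ∈ p × Unique (a ∷ b ∷ c ∷ [])
3≤∣p∣⇒∃-three-distinct p 3≤p with length<∣p∣⇒∃∉ p [] (≤-trans (s≤s z≤n) 3≤p)
... | a , a∈p , _ with length<∣p∣⇒∃∉ p [ a ] (≤-trans (s≤s (s≤s z≤n)) 3≤p)
... | b , b∈p , b∉ with length<∣p∣⇒∃∉ p (a ∷ [ b ]) 3≤p
... | c , c∈p , c∉ =
  a , b , c , a∈p , b∈p , c∈p ,
  ((λ a≡b → b∉ (here (≡.sym a≡b))) ∷ (λ a≡c → c∉ (here (≡.sym a≡c))) ∷ []) ∷
  ((λ b≡c → c∉ (there (here (≡.sym b≡c)))) ∷ []) ∷ [] ∷ []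

∣p∣≡2⇒≡⊎≡ : ∀ {p : Subset n} {a b y} → ∣ p ∣ ≡ 2 → a ∈ p → b ∈ p → a ≢ b → y ∈ p → y ≡ a ⊎ y ≡ b
∣p∣≡2⇒≡⊎≡ {a = a} {b} {y} p≡2 a∈p b∈p a≢b y∈p with y ≟ a | y ≟ b
... | yes y≡a | _       = inj₁ y≡a
... | no _    | yes y≡b = inj₂ y≡b
... | no y≢a  | no y≢b  =
  ⊥-elim (<⇒≱ (≤-reflexive (cong suc p≡2))
                (Unique⇒length≤∣p∣ ((a≢b ∷ (y≢a ∘ ≡.sym) ∷ []) ∷ ((y≢b ∘ ≡.sym) ∷ []) ∷ [] ∷ []) (a∈p ∷ b∈p ∷ y∈p ∷ [])))

∣removeAll∣≤ : ∀ (p : Subset n) xs → ∣ removeAll p xs ∣ ≤ ∣ p ∣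
∣removeAll∣≤ p []       = ≤-refl
∣removeAll∣≤ p (x ∷ xs) = ≤-trans (∣removeAll∣≤ (p - x) xs) (∣p─q∣≤∣p∣ p _)

∈-removeAll⁺ : ∀ (p : Subset n) xs {y} → y ∈ p → y ∉ˡ xs → y ∈ removeAll p xs
∈-removeAll⁺ p []       y∈p _   = y∈p
∈-removeAll⁺ p (x ∷ xs) y∈p y∉ = ∈-removeAll⁺ (p - x) xs (x∈p∧x≢y⇒x∈p-y y∈p (y∉ ∘ here)) (y∉ ∘ there)

Unique∧⊆⇒length≤ : ∀ {xs ys : List (Fin n)} → Unique xs → All (_∈ˡ ys) xs → length xs ≤ length ys
Unique∧⊆⇒length≤ {n} {xs} {ys} u xs⊆ys =
  ≤-trans (Unique⇒length≤∣p∣ u (All.tabulate ∈members⁺)) (⊆⇒∣p∣≤length members ys (All.lookup xs⊆ys ∘ ∈members⁻))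
  where
  members : Subset n
  members = tabulate (λ y → does (y ∈ˡ? xs))
  ∈members⁺ : ∀ {y} → y ∈ˡ xs → y ∈ members
  ∈members⁺ {y} y∈ = ∈-tabulate⁺ (dec-true (y ∈ˡ? xs) y∈)
  ∈members⁻ : ∀ {y} → y ∈ members → y ∈ˡ xs
  ∈members⁻ {y} y∈ with y ∈ˡ? xs | ∈-tabulate⁻ {f = λ y → does (y ∈ˡ? xs)} y∈
  ... | yes y∈xs | _ = y∈xs
  ... | no _     | ()

∣removeAll∣<∣p∣ : ∀ {p : Subset n} {y} ys → y ∈ p → ∣ removeAll p (y ∷ ys) ∣ < ∣ p ∣
∣removeAll∣<∣p∣ {p = p} {y} ys y∈p = ≤-trans (s≤s (∣removeAll∣≤ (p - y) ys)) (x∈p⇒∣p-x∣<∣p∣ y∈p)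

-- Walks, paths and cycles

module _ {G : Graph n} where

  Adj-sym : ∀ {u v} → Adj G u v → Adj G v u
  Adj-sym {u} {v} u~v = trans (Graph.sym G v u) u~v

  Adj-irrefl : ∀ {v} → ¬ Adj G v v
  Adj-irrefl {v} v~v with trans (≡.sym v~v) (irrefl G v)
  ... | ()

  Adj⇒≢ : ∀ {u v} → Adj G u v → u ≢ v
  Adj⇒≢ u~v refl = Adj-irrefl u~v

  Walk-tail : Walk G (x ∷ xs) → Walk G xs
  Walk-tail (w[-] _)  = w[]
  Walk-tail (w∷ _ w) = w

  Walk-++⁻ʳ : ∀ xs → Walk G (xs ++ ys) → Walk G ys
  Walk-++⁻ʳ []       w = w
  Walk-++⁻ʳ (x ∷ xs) w = Walk-++⁻ʳ xs (Walk-tail w)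

  Walk-++⁻ˡ : ∀ xs {x ys} → Walk G (xs ++ x ∷ ys) → Walk G (xs ++ [ x ])
  Walk-++⁻ˡ []           _         = w[-] _
  Walk-++⁻ˡ (a ∷ [])     (w∷ e _) = w∷ e (w[-] _)
  Walk-++⁻ˡ (a ∷ b ∷ xs) (w∷ e w) = w∷ e (Walk-++⁻ˡ (b ∷ xs) w)

  Walk-glue : ∀ xs {x ys} → Walk G (xs ++ [ x ]) → Walk G (x ∷ ys) → Walk G (xs ++ x ∷ ys)
  Walk-glue []           _         w′ = w′
  Walk-glue (a ∷ [])     (w∷ e _) w′ = w∷ e w′
  Walk-glue (a ∷ b ∷ xs) (w∷ e w) w′ = w∷ e (Walk-glue (b ∷ xs) w w′)

  Walk-reverse : Walk G xs → Walk G (reverse xs)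
  Walk-reverse w[]      = w[]
  Walk-reverse (w[-] x) = w[-] x
  Walk-reverse (w∷ {x} {y} {xs} x~y w) =
    subst (Walk G) (≡.sym reverse-x∷y∷xs)
      (Walk-glue (reverse xs) (subst (Walk G) (unfold-reverse y xs) (Walk-reverse w)) (w∷ (Adj-sym x~y) (w[-] x)))
    where
    open ≡.≡-Reasoning
    reverse-x∷y∷xs : reverse (x ∷ y ∷ xs) ≡ reverse xs ++ y ∷ [ x ]
    reverse-x∷y∷xs = begin
      reverse (x ∷ y ∷ xs)            ≡⟨ unfold-reverse x (y ∷ xs) ⟩
      reverse (y ∷ xs) ++ [ x ]       ≡⟨ cong (_++ [ x ]) (unfold-reverse y xs) ⟩
      (reverse xs ++ [ y ]) ++ [ x ]  ≡⟨ ++-assoc (reverse xs) [ y ] [ x ] ⟩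
      reverse xs ++ y ∷ [ x ]         ∎

nbrIn : Graph n → Subset n → Fin n → Subset n
nbrIn G S v = S ∩ nbr G v

module _ {G : Graph n} {S : Subset n} where

  ∈nbrIn⁺ : ∀ {v y} → y ∈ S → Adj G v y → y ∈ nbrIn G S v
  ∈nbrIn⁺ y∈S v~y = x∈p∩q⁺ (y∈S , ∈-tabulate⁺ v~y)

  ∈nbrIn⁻ : ∀ {v y} → y ∈ nbrIn G S v → y ∈ S × Adj G v y
  ∈nbrIn⁻ {v} y∈ with x∈p∩q⁻ S (nbr G v) y∈
  ... | y∈S , y∈nbr = y∈S , ∈-tabulate⁻ y∈nbr

IsPath : Graph n → Subset n → List (Fin n) → Set
IsPath G S xs = Unique xs × Walk G xs × All (_∈ S) xs

HasCycle≤ : Graph n → ℕ → Set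
HasCycle≤ G L = ∃₂ λ x xs → IsCycle G x xs × suc (length xs) ≤ L

girth≤ : ∀ {G : Graph n} {g L} → GirthAtLeast G g → HasCycle≤ G L → g ≤ L
girth≤ girth (x , xs , cycle , len) = ≤-trans (girth x xs cycle) len

module _ {G : Graph n} where

  closing-edge⇒cycle : ∀ d R {c} → 1 ≤ length R → Unique (d ∷ R ++ [ c ]) → Walk G (d ∷ R ++ [ c ]) →
                       Adj G c d → IsCycle G d (R ++ [ c ])
  closing-edge⇒cycle d R {c} 1≤R uniq walk c~d =
    subst (2 ≤_) (≡.sym (length-++ R)) (+-monoˡ-≤ 1 1≤R) ,
    uniq ,
    subst (Walk G) (cong (d ∷_) (≡.sym (++-assoc R [ c ] [ d ]))) (Walk-glue (d ∷ R) walk (w∷ c~d (w[-] d)))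

  back-edge⇒cycle : ∀ P {q c d} → Unique (P ++ q ∷ [ c ]) → Walk G (P ++ q ∷ [ c ]) → Adj G c d → d ∈ˡ P →
                    HasCycle≤ G (length (P ++ q ∷ [ c ]))
  back-edge⇒cycle P {q} {c} {d} uniq walk c~d d∈P with ∈-∃++ d∈P
  ... | P₁ , P₂ , refl =
    d , (P₂ ++ [ q ]) ++ [ c ] ,
    closing-edge⇒cycle d (P₂ ++ [ q ]) (subst (1 ≤_) (≡.sym (length-++ P₂)) (m≤n+m 1 (length P₂)))
      (Unique-++⁻ʳ P₁ (subst Unique split uniq)) (Walk-++⁻ʳ P₁ (subst (Walk G) split walk)) c~d ,
    subst (_ ≤_) (cong length (≡.sym split)) (subst (_ ≤_) (≡.sym (length-++ P₁)) (m≤n+m _ (length P₁)))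
    where
    split : (P₁ ++ d ∷ P₂) ++ q ∷ [ c ] ≡ P₁ ++ d ∷ (P₂ ++ [ q ]) ++ [ c ]
    split = trans (++-assoc P₁ (d ∷ P₂) (q ∷ [ c ])) (cong (λ X → P₁ ++ d ∷ X) (≡.sym (++-assoc P₂ [ q ] [ c ])))

  disjoint-paths⇒cycle : ∀ a P z Q → Unique (a ∷ P ++ [ z ]) → Unique (a ∷ Q ++ [ z ]) →
                         Walk G (a ∷ P ++ [ z ]) → Walk G (a ∷ Q ++ [ z ]) → All (_∉ˡ Q) P →
                         1 ≤ length P + length Q → IsCycle G a (P ++ z ∷ reverse Q)
  disjoint-paths⇒cycle a P z Q uP uQ wP wQ P∉Q 1≤P+Q =
    subst (2 ≤_) (≡.sym (trans (length-++-∷-reverse P Q) (+-suc (length P) (length Q)))) (s≤s 1≤P+Q) ,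
    Unique.++⁺ (Unique-++⁻ˡ (a ∷ P) uP) (Unique-++⁻ˡ (z ∷ reverse Q) uQ⁻¹) disjoint ,
    subst (Walk G) (cong (a ∷_) (≡.sym (++-assoc P (z ∷ reverse Q) [ a ])))
      (Walk-glue (a ∷ P) wP (subst (Walk G) (reverse-path a Q z) (Walk-reverse wQ)))
    where
    uQ⁻¹ : Unique (z ∷ reverse Q ++ [ a ])
    uQ⁻¹ = subst Unique (reverse-path a Q z) (Unique-reverse⁺ uQ)
    disjoint : ∀ {v} → ¬ (v ∈ˡ a ∷ P × v ∈ˡ z ∷ reverse Q)
    disjoint (here refl  , v∈)               = Unique-++⇒disjoint (z ∷ reverse Q) uQ⁻¹ v∈ (here refl)
    disjoint (there v∈P , here refl)         = Unique-++⇒disjoint P (Unique-++⁻ʳ [ a ] uP) v∈P (here refl)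
    disjoint (there v∈P , there v∈reverseQ) = All.lookup P∉Q v∈P (Any.reverse⁻ v∈reverseQ)

  two-paths⇒cycle : ∀ {a x y} P Q {e} → x ≢ y → Unique (a ∷ x ∷ P) → Unique (a ∷ y ∷ Q) →
                    Walk G (a ∷ x ∷ P) → Walk G (a ∷ y ∷ Q) → e ∈ˡ x ∷ P → e ∈ˡ y ∷ Q →
                    HasCycle≤ G (suc (length P) + suc (length Q))
  two-paths⇒cycle {a} {x} {y} P Q x≢y uP uQ wP wQ e∈xP e∈yQ
    with first-shared (x ∷ P) (y ∷ Q) e∈xP e∈yQ
  ... | P₁ , z , P₂ , xP≡ , z∈yQ , P₁∉yQ with ∈-∃++ z∈yQ
  ... | Q₁ , Q₂ , yQ≡ =
    a , P₁ ++ z ∷ reverse Q₁ ,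
    disjoint-paths⇒cycle a P₁ z Q₁
      (Unique-prefix (a ∷ P₁) (subst Unique (cong (a ∷_) xP≡) uP))
      (Unique-prefix (a ∷ Q₁) (subst Unique (cong (a ∷_) yQ≡) uQ))
      (Walk-++⁻ˡ (a ∷ P₁) (subst (Walk G) (cong (a ∷_) xP≡) wP))
      (Walk-++⁻ˡ (a ∷ Q₁) (subst (Walk G) (cong (a ∷_) yQ≡) wQ))
      (All.map (λ v∉yQ v∈Q₁ → v∉yQ (subst (_ ∈ˡ_) (≡.sym yQ≡) (∈-++⁺ˡ v∈Q₁))) P₁∉yQ)
      (nonempty P₁ Q₁ xP≡ yQ≡) ,
    subst (_≤ suc (length P) + suc (length Q)) (cong suc (≡.sym (length-++-∷-reverse P₁ Q₁)))
      (+-mono-≤ (subst (suc (length P₁) ≤_) (cong length (≡.sym xP≡)) (1+length≤length-++-∷ P₁))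
                (subst (suc (length Q₁) ≤_) (cong length (≡.sym yQ≡)) (1+length≤length-++-∷ Q₁)))
    where
    nonempty : ∀ P₁ Q₁ {z P₂ Q₂} → x ∷ P ≡ P₁ ++ z ∷ P₂ → y ∷ Q ≡ Q₁ ++ z ∷ Q₂ → 1 ≤ length P₁ + length Q₁
    nonempty []      []      refl refl = ⊥-elim (x≢y refl)
    nonempty []      (_ ∷ _) _    _    = s≤s z≤n
    nonempty (_ ∷ _) _       _    _    = s≤s z≤n

first-step : ∀ {G : Graph n} {a b} I → Walk G (a ∷ I ++ [ b ]) → ∃ λ g → Adj G a g × (g ≡ b ⊎ g ∈ˡ I)
first-step []      (w∷ a~b _) = _ , a~b , inj₁ refl
first-step (x ∷ I) (w∷ a~x _) = x , a~x , inj₂ (here refl)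

-- Vertices of degree 2 on paths and ears

module _ {G : Graph n} {S : Subset n} where

  interior-neighbours : ∀ {a I b c} → IsPath G S (a ∷ I ++ [ b ]) → c ∈ˡ I →
                        ∃₂ λ q r → q ≢ r × q ∈ nbrIn G S c × r ∈ nbrIn G S c ×
                                   q ∈ˡ a ∷ I ++ [ b ] × r ∈ˡ a ∷ I ++ [ b ]
  interior-neighbours {a} {I} {b} (uniq , walk , inS) c∈I with split-around a I b c∈I
  ... | B , q , r , C , eq
    with Unique-++⁻ʳ B (subst Unique eq uniq) | Walk-++⁻ʳ B (subst (Walk G) eq walk)
       | All.++⁻ʳ B (subst (All (_∈ S)) eq inS)
  ... | (_ ∷ q≢r ∷ _) ∷ _ | w∷ q~c (w∷ c~r _) | q∈S ∷ _ ∷ r∈S ∷ _ =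
    q , r , q≢r , ∈nbrIn⁺ {G = G} q∈S (Adj-sym {G = G} q~c) , ∈nbrIn⁺ {G = G} r∈S c~r ,
    subst (q ∈ˡ_) (≡.sym eq) (∈-++⁺ʳ B (here refl)) ,
    subst (r ∈ˡ_) (≡.sym eq) (∈-++⁺ʳ B (there (there (here refl))))

  interior-degree≥2 : ∀ {a I b c} → IsPath G S (a ∷ I ++ [ b ]) → c ∈ˡ I → 2 ≤ degIn G S c
  interior-degree≥2 path c∈I with interior-neighbours path c∈I
  ... | q , r , q≢r , q∈N , r∈N , _ = Unique⇒length≤∣p∣ ((q≢r ∷ []) ∷ [] ∷ []) (q∈N ∷ r∈N ∷ [])

  degree-2-neighbour∈path : ∀ {a I b c y} → IsPath G S (a ∷ I ++ [ b ]) → c ∈ˡ I → degIn G S c ≡ 2 →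
                            y ∈ nbrIn G S c → y ∈ˡ a ∷ I ++ [ b ]
  degree-2-neighbour∈path path c∈I deg≡2 y∈N with interior-neighbours path c∈I
  ... | q , r , q≢r , q∈N , r∈N , q∈path , r∈path with ∣p∣≡2⇒≡⊎≡ deg≡2 q∈N r∈N q≢r y∈N
  ...   | inj₁ refl = q∈path
  ...   | inj₂ refl = r∈path

  degree-2-walk-trapped : ∀ {u I v z J w} → IsPath G S (u ∷ I ++ [ v ]) →
                          degIn G S u ≢ 2 → degIn G S v ≢ 2 → z ∈ˡ I →
                          Walk G (z ∷ J ++ [ w ]) → All (_∈ S) (J ++ [ w ]) →
                          All (λ x → degIn G S x ≡ 2) (z ∷ J) →
                          All (_∈ˡ I) J × w ∈ˡ u ∷ I ++ [ v ]
  degree-2-walk-trapped {J = []} path _ _ z∈I (w∷ z~w _) (w∈S ∷ []) (z² ∷ []) =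
    [] , degree-2-neighbour∈path path z∈I z² (∈nbrIn⁺ {G = G} w∈S z~w)
  degree-2-walk-trapped {I = I} {J = j ∷ J} path u≠2 v≠2 z∈I (w∷ z~j walk) (j∈S ∷ inS) (z² ∷ j² ∷ J²)
    with degree-2-neighbour∈path path z∈I z² (∈nbrIn⁺ {G = G} j∈S z~j)
  ... | here refl = ⊥-elim (u≠2 j²)
  ... | there j∈I++[v] with ∈-++⁻ I j∈I++[v]
  ...   | inj₂ (here refl) = ⊥-elim (v≠2 j²)
  ...   | inj₁ j∈I with degree-2-walk-trapped path u≠2 v≠2 j∈I walk inS (j² ∷ J²)
  ...     | J⊆I , w∈path = j∈I ∷ J⊆I , w∈path

  ear-trapped : ∀ {u I v a ys b x} → IsPath G S (u ∷ I ++ [ v ]) → degIn G S u ≢ 2 → degIn G S v ≢ 2 →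
                StrictEar G S a ys b → x ∈ˡ ys → x ∈ˡ I →
                All (_∈ˡ I) ys × a ∈ˡ u ∷ I ++ [ v ] × b ∈ˡ u ∷ I ++ [ v ]
  ear-trapped {a = a} {ys} {b} {x} path u≠2 v≠2 (a∈S , b∈S , ys⊆S , _ , walk , ys²) x∈ys x∈I with ∈-∃++ x∈ys
  ... | Y₁ , Y₂ , refl with forward | backward
    where
    split : a ∷ (Y₁ ++ x ∷ Y₂) ++ [ b ] ≡ (a ∷ Y₁) ++ x ∷ Y₂ ++ [ b ]
    split = cong (a ∷_) (++-assoc Y₁ (x ∷ Y₂) [ b ])
    walk′ = subst (Walk G) split walk
    x∷Y₂² = All.++⁻ʳ Y₁ ys²
    forward = degree-2-walk-trapped path u≠2 v≠2 x∈I (Walk-++⁻ʳ (a ∷ Y₁) walk′)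
                (All.++⁺ (All.tail (All.++⁻ʳ Y₁ ys⊆S)) (b∈S ∷ [])) x∷Y₂²
    backward = degree-2-walk-trapped path u≠2 v≠2 x∈I
                 (subst (Walk G) (reverse-path a Y₁ x) (Walk-reverse (Walk-++⁻ˡ (a ∷ Y₁) walk′)))
                 (All.++⁺ (All-reverse⁺ (All.++⁻ˡ Y₁ ys⊆S)) (a∈S ∷ []))
                 (All.head x∷Y₂² ∷ All-reverse⁺ (All.++⁻ˡ Y₁ ys²))
  ... | Y₂⊆I , b∈path | reverse-Y₁⊆I , a∈path =
    All.++⁺ (All.tabulate (All.lookup reverse-Y₁⊆I ∘ Any.reverse⁺)) (x∈I ∷ Y₂⊆I) , a∈path , b∈path

  StrictEar⇒IsPath : ∀ {a ys b} → StrictEar G S a ys b → IsPath G S (a ∷ ys ++ [ b ])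
  StrictEar⇒IsPath (a∈S , b∈S , ys⊆S , uniq , walk , _) = uniq , walk , a∈S ∷ All.++⁺ ys⊆S (b∈S ∷ [])

  StrictEar-reverse : ∀ {a ys b} → StrictEar G S a ys b → StrictEar G S b (reverse ys) a
  StrictEar-reverse {a} {ys} {b} (a∈S , b∈S , ys⊆S , uniq , walk , ys²) =
    b∈S , a∈S , All-reverse⁺ ys⊆S , subst Unique reversed (Unique-reverse⁺ uniq) ,
    subst (Walk G) reversed (Walk-reverse walk) , All-reverse⁺ ys²
    where reversed = reverse-path a ys b

  StrictEar-extend : ∀ {a ys c d} → StrictEar G S a ys c → degIn G S c ≡ 2 → d ∈ nbrIn G S c →
                     d ∉ˡ a ∷ ys ++ [ c ] → StrictEar G S a (ys ++ [ c ]) d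
  StrictEar-extend {a} {ys} {c} {d} (a∈S , c∈S , ys⊆S , uniq , walk , ys²) c² d∈N d∉ =
    a∈S , proj₁ (∈nbrIn⁻ {G = G} d∈N) , All.++⁺ ys⊆S (c∈S ∷ []) , Unique-∷ʳ⁺ uniq d∉ ,
    subst (Walk G) (cong (a ∷_) (≡.sym (++-assoc ys [ c ] [ d ])))
      (Walk-glue (a ∷ ys) walk (w∷ (proj₂ (∈nbrIn⁻ {G = G} d∈N)) (w[-] d))) ,
    All.++⁺ ys² (c² ∷ [])

  StrictEar-ends-distinct : ∀ {a ys b} → StrictEar G S a ys b → a ≢ b
  StrictEar-ends-distinct {ys = ys} (_ , _ , _ , a∉ ∷ _ , _) a≡b = All.lookup a∉ (∈-++⁺ʳ ys (here a≡b)) refl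

  StrictEar-interior-unique : ∀ {a ys b} → StrictEar G S a ys b → Unique ys
  StrictEar-interior-unique {ys = ys} (_ , _ , _ , _ ∷ uniq , _) = Unique-++⁻ˡ ys uniq

  StrictEar-≢2⇒end : ∀ {a ys b w} → StrictEar G S a ys b → degIn G S w ≢ 2 → w ∈ˡ a ∷ ys ++ [ b ] →
                     w ≡ a ⊎ w ≡ b
  StrictEar-≢2⇒end _ _ (here w≡a) = inj₁ w≡a
  StrictEar-≢2⇒end {ys = ys} (_ , _ , _ , _ , _ , ys²) w≢2 (there w∈) with ∈-++⁻ ys w∈
  ... | inj₁ w∈ys       = ⊥-elim (w≢2 (All.lookup ys² w∈ys))
  ... | inj₂ (here w≡b) = inj₂ w≡b

  ears-sharing-interior : ∀ {u I v u′ I′ v′ x} → StrictEar G S u I v → StrictEar G S u′ I′ v′ →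
                          degIn G S u ≢ 2 → degIn G S v ≢ 2 → degIn G S u′ ≢ 2 → degIn G S v′ ≢ 2 →
                          x ∈ˡ I → x ∈ˡ I′ →
                          (u ≡ u′ ⊎ u ≡ v′) × (v ≡ u′ ⊎ v ≡ v′)
  ears-sharing-interior ear ear′ u≢2 v≢2 u′≢2 v′≢2 x∈I x∈I′
    with ear-trapped (StrictEar⇒IsPath ear′) u′≢2 v′≢2 ear x∈I x∈I′
  ... | _ , u∈ , v∈ = StrictEar-≢2⇒end ear′ u≢2 u∈ , StrictEar-≢2⇒end ear′ v≢2 v∈

-- A subdivision survives every p-reduction

module Forward {n m k} {G : Graph n} {F : Graph m}
               (minDeg3 : ∀ w → 3 ≤ deg F w) (H : SubdivisionIn k F G) where
  open SubdivisionIn H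

  branch-path-unique : ∀ u v → u <ᶠ v → Adj F u v → Unique (φ u ∷ int u v ++ [ φ v ])
  branch-path-unique u v u<v u~v =
    All.++⁺ (All.tabulate λ x∈ φu≡x → avoid u v u<v u~v _ x∈ u φu≡x) ((Fin.<⇒≢ u<v ∘ φ-inj u v) ∷ []) ∷
    Unique-∷ʳ⁺ (uniq u v u<v u~v) (λ φv∈ → avoid u v u<v u~v _ φv∈ v refl)

  -- the path of H from φ w to φ j, in whichever direction H stores it
  record Route (w j : Fin m) : Set where
    field
      interior  : List (Fin n)
      walk      : Walk G (φ w ∷ interior ++ [ φ j ])
      u v       : Fin m
      u<v       : u <ᶠ v
      u~v       : Adj F u v
      ends      : (u ≡ w × v ≡ j) ⊎ (u ≡ j × v ≡ w)
      interior⊆ : ∀ {x} → x ∈ˡ interior → x ∈ˡ int u v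

  route : ∀ w j → Adj F w j → Route w j
  route w j w~j with Fin.<-cmp w j
  ... | tri< w<j _ _ = record
    { interior = int w j ; walk = path w j w<j w~j ; u<v = w<j ; u~v = w~j
    ; ends = inj₁ (refl , refl) ; interior⊆ = λ x∈ → x∈ }
  ... | tri≈ _ refl _ = ⊥-elim (Adj-irrefl {G = F} w~j)
  ... | tri> _ _ j<w = record
    { interior = reverse (int j w)
    ; walk = subst (Walk G) (reverse-path (φ j) (int j w) (φ w)) (Walk-reverse (path j w j<w j~w))
    ; u<v = j<w ; u~v = j~w ; ends = inj₂ (refl , refl) ; interior⊆ = Any.reverse⁻ }
    where j~w = Adj-sym {G = F} w~j

  OnRoute : ∀ {w j} → Route w j → Fin n → Set
  OnRoute {j = j} r g = g ≡ φ j ⊎ g ∈ˡ int (Route.u r) (Route.v r)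

  first-on-route : ∀ {w j} (r : Route w j) → ∃ λ g → Adj G (φ w) g × OnRoute r g
  first-on-route r with first-step (Route.interior r) (Route.walk r)
  ... | g , w~g , inj₁ g≡φj = g , w~g , inj₁ g≡φj
  ... | g , w~g , inj₂ g∈  = g , w~g , inj₂ (Route.interior⊆ r g∈)

  routes-disjoint : ∀ {w j₁ j₂ g} (r₁ : Route w j₁) (r₂ : Route w j₂) → j₁ ≢ j₂ → OnRoute r₁ g → ¬ OnRoute r₂ g
  routes-disjoint r₁ r₂ j₁≢j₂ (inj₁ refl) (inj₁ g≡φj₂) = j₁≢j₂ (φ-inj _ _ g≡φj₂)
  routes-disjoint r₁ r₂ j₁≢j₂ (inj₁ refl) (inj₂ g∈₂) =
    avoid (Route.u r₂) (Route.v r₂) (Route.u<v r₂) (Route.u~v r₂) _ g∈₂ _ refl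
  routes-disjoint r₁ r₂ j₁≢j₂ (inj₂ g∈₁) (inj₁ refl) =
    avoid (Route.u r₁) (Route.v r₁) (Route.u<v r₁) (Route.u~v r₁) _ g∈₁ _ refl
  routes-disjoint {w} {j₁} {j₂} r₁ r₂ j₁≢j₂ (inj₂ g∈₁) (inj₂ g∈₂) =
    disj _ _ _ _ (Route.u<v r₁) (Route.u~v r₁) (Route.u<v r₂) (Route.u~v r₂)
         (different-edges (Route.ends r₁) (Route.ends r₂)) _ g∈₁ g∈₂
    where
    different-edges : ∀ {u₁ v₁ u₂ v₂} → (u₁ ≡ w × v₁ ≡ j₁) ⊎ (u₁ ≡ j₁ × v₁ ≡ w) →
                      (u₂ ≡ w × v₂ ≡ j₂) ⊎ (u₂ ≡ j₂ × v₂ ≡ w) → (u₁ , v₁) ≢ (u₂ , v₂)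
    different-edges (inj₁ (refl , refl)) (inj₁ (refl , refl)) refl = j₁≢j₂ refl
    different-edges (inj₁ (refl , refl)) (inj₂ (refl , refl)) refl = j₁≢j₂ refl
    different-edges (inj₂ (refl , refl)) (inj₁ (refl , refl)) refl = j₁≢j₂ refl
    different-edges (inj₂ (refl , refl)) (inj₂ (refl , refl)) refl = j₁≢j₂ refl

  Retains : Subset n → Set
  Retains S = (∀ w → φ w ∈ S) × (∀ u v → u <ᶠ v → Adj F u v → All (_∈ S) (int u v))

  module Retained {S : Subset n} (retains : Retains S) where

    branch-path : ∀ u v → u <ᶠ v → Adj F u v → IsPath G S (φ u ∷ int u v ++ [ φ v ])
    branch-path u v u<v u~v =
      branch-path-unique u v u<v u~v , path u v u<v u~v ,
      proj₁ retains u ∷ All.++⁺ (proj₂ retains u v u<v u~v) (proj₁ retains v ∷ [])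

    neighbour-towards : ∀ {w j} (r : Route w j) → ∃ λ g → g ∈ nbrIn G S (φ w) × OnRoute r g
    neighbour-towards r with first-on-route r
    ... | g , w~g , inj₁ refl = g , ∈nbrIn⁺ {G = G} (proj₁ retains _) w~g , inj₁ refl
    ... | g , w~g , inj₂ g∈ =
      g , ∈nbrIn⁺ {G = G} (All.lookup (proj₂ retains _ _ (Route.u<v r) (Route.u~v r)) g∈) w~g , inj₂ g∈

    branch-degree≥3 : ∀ w → 3 ≤ degIn G S (φ w)
    branch-degree≥3 w with 3≤∣p∣⇒∃-three-distinct (nbrIn F ⊤ w) (minDeg3 w)
    ... | j₁ , j₂ , j₃ , j₁∈ , j₂∈ , j₃∈ , (j₁≢j₂ ∷ j₁≢j₃ ∷ []) ∷ (j₂≢j₃ ∷ []) ∷ [] ∷ [] =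
      Unique⇒length≤∣p∣ ((apart r₁ r₂ j₁≢j₂ ∷ apart r₁ r₃ j₁≢j₃ ∷ []) ∷ (apart r₂ r₃ j₂≢j₃ ∷ []) ∷ [] ∷ [])
                 (g∈N r₁ ∷ g∈N r₂ ∷ g∈N r₃ ∷ [])
      where
      towards : ∀ {j} → j ∈ nbrIn F ⊤ w → Route w j
      towards j∈ = route w _ (proj₂ (∈nbrIn⁻ {G = F} j∈))
      r₁ = towards j₁∈
      r₂ = towards j₂∈
      r₃ = towards j₃∈
      g : ∀ {j} → Route w j → Fin n
      g r = proj₁ (neighbour-towards r)
      g∈N : ∀ {j} (r : Route w j) → g r ∈ nbrIn G S (φ w)
      g∈N r = proj₁ (proj₂ (neighbour-towards r))
      apart : ∀ {j j′} (r : Route w j) (r′ : Route w j′) → j ≢ j′ → g r ≢ g r′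
      apart r r′ j≢j′ g≡g′ =
        routes-disjoint r r′ j≢j′ (proj₂ (proj₂ (neighbour-towards r)))
                        (subst (OnRoute r′) (≡.sym g≡g′) (proj₂ (proj₂ (neighbour-towards r′))))

    branch-degree≢2 : ∀ w → degIn G S (φ w) ≢ 2
    branch-degree≢2 w deg≡2 = <-irrefl refl (subst (3 ≤_) deg≡2 (branch-degree≥3 w))

    ear-misses-branch-paths : ∀ {a ys b u v x} → StrictEar G S a ys b → k < length ys →
                              u <ᶠ v → Adj F u v → x ∈ˡ ys → x ∉ˡ int u v
    ear-misses-branch-paths {a = a} {ys} {u = u} {v} ear@(_ , _ , _ , ear-unique , _) k<ys u<v u~v x∈ys x∈int =
      <⇒≱ k<ys (≤-trans (Unique∧⊆⇒length≤ ys-unique ys⊆int) (short u v u<v u~v))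
      where
      ys⊆int = proj₁ (ear-trapped (branch-path u v u<v u~v) (branch-degree≢2 u) (branch-degree≢2 v)
                                  ear x∈ys x∈int)
      ys-unique = Unique-++⁻ˡ ys (Unique-++⁻ʳ [ a ] ear-unique)

  Retains-⊤ : Retains ⊤
  Retains-⊤ = (λ _ → ∈⊤) , (λ _ _ _ _ → All.tabulate λ _ → ∈⊤)

  Retains-remove : ∀ {S v} → Retains S → degIn G S v < 2 → Retains (S - v)
  Retains-remove {S} {v} retains deg<2 =
    (λ w → survives (≤-trans (n≤1+n 2) (branch-degree≥3 w)) (proj₁ retains w)) ,
    (λ i j i<j i~j → All.tabulate λ x∈ →
       survives (interior-degree≥2 (branch-path i j i<j i~j) x∈) (All.lookup (proj₂ retains i j i<j i~j) x∈))
    where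
    open Retained retains
    survives : ∀ {x} → 2 ≤ degIn G S x → x ∈ S → x ∈ S - v
    survives 2≤deg x∈S = x∈p∧x≢y⇒x∈p-y x∈S λ x≡v → <⇒≱ deg<2 (subst (λ y → 2 ≤ degIn G S y) x≡v 2≤deg)

  Retains-remove-ear : ∀ {S a ys b} → Retains S → StrictEar G S a ys b → k < length ys →
                       Retains (removeAll S ys)
  Retains-remove-ear {S} {ys = ys} retains ear@(_ , _ , _ , _ , _ , ys²) k<ys =
    (λ w → ∈-removeAll⁺ S ys (proj₁ retains w) (λ φw∈ys → branch-degree≢2 w (All.lookup ys² φw∈ys))) ,
    (λ u v u<v u~v → All.tabulate λ x∈ →
       ∈-removeAll⁺ S ys (All.lookup (proj₂ retains u v u<v u~v) x∈)
                    (λ x∈ys → ear-misses-branch-paths ear k<ys u<v u~v x∈ys x∈))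
    where open Retained retains

  Retains-reduction : ∀ {p S S′} → suc k < p → Retains S → Reduction p G S S′ → Retains S′
  Retains-reduction _ retains (delIsolated _ _ deg≡0) =
    Retains-remove retains (subst (_< 2) (≡.sym deg≡0) (s≤s z≤n))
  Retains-reduction _ retains (delLeaf _ _ deg≡1) =
    Retains-remove retains (subst (_< 2) (≡.sym deg≡1) (s≤s (s≤s z≤n)))
  Retains-reduction 1+k<p retains (delEar _ _ _ ear p≤1+ys) =
    Retains-remove-ear retains ear (≤-pred (≤-trans 1+k<p p≤1+ys))

  Retains⇒¬Reducible : ∀ {p S} → suc k < p → Fin m → Retains S → ¬ Reducible p G S
  Retains⇒¬Reducible _     w retains done              = ∉⊥ (proj₁ retains w)
  Retains⇒¬Reducible 1+k<p w retains (step red reducible) =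
    Retains⇒¬Reducible 1+k<p w (Retains-reduction 1+k<p retains red) reducible

path-degenerate⇒no-subdivision : ∀ {n p k} {G : Graph n} → suc k < p →
                                 PathDegenerate p G → ¬ ContainsSubdivMinDeg3 k G
path-degenerate⇒no-subdivision 1+k<p degenerate (_ , F , s≤s _ , minDeg3 , H) =
  Retains⇒¬Reducible 1+k<p zero Retains-⊤ degenerate
  where open Forward minDeg3 H

-- Without a long ear, the threads between vertices of degree at least 3 form a subdivision

sum<2p∸1 : ∀ {p L₁ L₂} → L₁ < p → L₂ < p → L₁ + L₂ < 2 * p ∸ 1
sum<2p∸1 {suc q} (s≤s L₁≤q) (s≤s L₂≤q) =
  ≤-trans (s≤s (+-mono-≤ L₁≤q L₂≤q))
          (≤-reflexive (trans (≡.sym (+-suc q q)) (cong (λ r → q + suc r) (≡.sym (+-identityʳ q)))))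

suc<p : ∀ {p L} → 2 ≤ p → L ≤ p ∸ 2 → suc L < p
suc<p (s≤s (s≤s _)) L≤p∸2 = s≤s (s≤s L≤p∸2)

p≤2+ : ∀ {p L} → L + 0 ≡ p ∸ 2 → p ≤ 2 + L
p≤2+ {p} {L} L+0≡ = subst (λ k → p ≤ 2 + k) (trans (≡.sym L+0≡) (+-identityʳ L)) (m≤n+m∸n p 2)

+≡⇒≤ : ∀ {l m n} → l + m ≡ n → l ≤ n
+≡⇒≤ {l} {m} l+m≡n = subst (l ≤_) l+m≡n (m≤m+n l m)

module Backward {n p} {G : Graph n} (2≤p : 2 ≤ p) (girth : GirthAtLeast G (2 * p ∸ 1)) (S : Subset n) where

  δ : Fin n → ℕ
  δ = degIn G S

  no-short-cycle : ∀ {L₁ L₂} → L₁ < p → L₂ < p → ¬ HasCycle≤ G (L₁ + L₂)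
  no-short-cycle L₁<p L₂<p cycle = <⇒≱ (sum<2p∸1 L₁<p L₂<p) (girth≤ girth cycle)

  LongEar : Set
  LongEar = ∃₂ λ a ys → ∃ λ b → StrictEar G S a ys b × p ≤ suc (length ys)

  record Thread (a x : Fin n) : Set where
    field
      interior : List (Fin n)
      end      : Fin n
      ear      : StrictEar G S a interior end
      short    : length interior ≤ p ∸ 2
      end≢2    : δ end ≢ 2
      starts   : ∃ λ r → interior ++ [ end ] ≡ x ∷ r

  fresh-neighbour : ∀ {a R c} → StrictEar G S a R c → length R ≤ p ∸ 2 → δ c ≡ 2 →
                    ∃ λ d → d ∈ nbrIn G S c × d ∉ˡ a ∷ R ++ [ c ]
  fresh-neighbour {a} {R} {c} (_ , _ , _ , uniq , walk , _) R≤ c² with ∷-∃∷ʳ a R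
  ... | Q , q , a∷R≡Q∷ʳq with 2≤∣p∣⇒∃≢ (nbrIn G S c) q (≤-reflexive (≡.sym c²))
  ... | d , d∈N , d≢q = d , d∈N , d∉
    where
    path≡ : a ∷ R ++ [ c ] ≡ Q ++ q ∷ [ c ]
    path≡ = trans (cong (_++ [ c ]) a∷R≡Q∷ʳq) (++-assoc Q [ q ] [ c ])
    c~d = proj₂ (∈nbrIn⁻ {G = G} d∈N)
    length≡ : length (Q ++ q ∷ [ c ]) ≡ 1 + suc (length R)
    length≡ = trans (cong length (≡.sym path≡)) (cong suc (length-∷ʳ R))
    d∉ : d ∉ˡ a ∷ R ++ [ c ]
    d∉ d∈ with ∈-++⁻ Q (subst (d ∈ˡ_) path≡ d∈)
    ... | inj₂ (here d≡q)         = d≢q d≡q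
    ... | inj₂ (there (here d≡c)) = Adj-irrefl {G = G} (subst (Adj G c) d≡c c~d)
    ... | inj₁ d∈Q =
      no-short-cycle 2≤p (suc<p 2≤p R≤)
        (subst (HasCycle≤ G) length≡
          (back-edge⇒cycle Q (subst Unique path≡ uniq) (subst (Walk G) path≡ walk) c~d d∈Q))

  grow : ∀ k {a R c x} → StrictEar G S a R c → length R + k ≡ p ∸ 2 → (∃ λ r → R ++ [ c ] ≡ x ∷ r) →
         LongEar ⊎ Thread a x
  grow k {a} {R} {c} ear R+k≡ starts with δ c ℕ.≟ 2
  ... | no c≢2 = inj₂ record
    { interior = R ; end = c ; ear = ear ; short = +≡⇒≤ R+k≡ ; end≢2 = c≢2 ; starts = starts }
  ... | yes c² with fresh-neighbour ear (+≡⇒≤ R+k≡) c²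
  ...   | d , d∈N , d∉ with StrictEar-extend ear c² d∈N d∉ | k
  ...     | ear′ | zero   =
    inj₁ (a , R ++ [ c ] , d , ear′ , subst (p ≤_) (cong suc (≡.sym (length-∷ʳ R))) (p≤2+ R+k≡))
  ...     | ear′ | suc k′ =
    grow k′ ear′ (trans (cong (_+ k′) (length-∷ʳ R)) (trans (≡.sym (+-suc (length R) k′)) R+k≡))
         (proj₁ starts ++ [ d ] , cong (_++ [ d ]) (proj₂ starts))

  thread-or-long-ear : ∀ {a x} → a ∈ S → x ∈ nbrIn G S a → LongEar ⊎ Thread a x
  thread-or-long-ear {a} {x} a∈S x∈N with ∈nbrIn⁻ {G = G} x∈N
  ... | x∈S , a~x =
    grow (p ∸ 2) (a∈S , x∈S , [] , ((Adj⇒≢ {G = G} a~x ∷ []) ∷ [] ∷ []) , w∷ a~x (w[-] x) , []) refl ([] , refl)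

  Threads : Set
  Threads = ∀ a x → a ∈ S → x ∈ nbrIn G S a → Thread a x

  long-ear-or-threads : LongEar ⊎ Threads
  long-ear-or-threads
    with some⊎all {A = λ _ → LongEar} (λ a → map₁ proj₂ (some⊎all {A = λ _ → LongEar} (at a)))
    where
    at : ∀ a x → LongEar ⊎ (a ∈ S → x ∈ nbrIn G S a → Thread a x)
    at a x with a ∈? S | x ∈? nbrIn G S a
    ... | yes a∈S | yes x∈N = map₂ (λ t _ _ → t) (thread-or-long-ear a∈S x∈N)
    ... | no a∉S  | _       = inj₂ λ a∈S → ⊥-elim (a∉S a∈S)
    ... | yes _   | no x∉N  = inj₂ λ _ x∈N → ⊥-elim (x∉N x∈N)
  ... | inj₁ (_ , ear) = inj₁ ear
  ... | inj₂ threads   = inj₂ threads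

  thread-as-path : ∀ {a x} (t : Thread a x) →
                   ∃ λ r → Unique (a ∷ x ∷ r) × Walk G (a ∷ x ∷ r) × Thread.end t ∈ˡ x ∷ r × suc (length r) < p
  thread-as-path {a} record { interior = ys ; end = b ; ear = (_ , _ , _ , uniq , walk , _) ; short = short
                            ; starts = r , ys∷ʳb≡x∷r } =
    r , subst Unique (cong (a ∷_) ys∷ʳb≡x∷r) uniq , subst (Walk G) (cong (a ∷_) ys∷ʳb≡x∷r) walk ,
    subst (b ∈ˡ_) ys∷ʳb≡x∷r (∈-++⁺ʳ ys (here refl)) ,
    subst (_< p) (trans (≡.sym (length-∷ʳ ys)) (cong length ys∷ʳb≡x∷r)) (suc<p 2≤p short)

  thread-ends-distinct : ∀ {a x x′} (t : Thread a x) (t′ : Thread a x′) → x ≢ x′ → Thread.end t ≢ Thread.end t′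
  thread-ends-distinct t t′ x≢x′ end≡end′ with thread-as-path t | thread-as-path t′
  ... | r , uniq , walk , end∈ , r<p | r′ , uniq′ , walk′ , end′∈ , r′<p =
    no-short-cycle r<p r′<p
      (two-paths⇒cycle r r′ x≢x′ uniq uniq′ walk walk′ end∈ (subst (_∈ˡ _) (≡.sym end≡end′) end′∈))

  Segment : Fin n → List (Fin n) → Fin n → Set
  Segment a I b = StrictEar G S a I b × length I ≤ p ∸ 2

  Segment-reverse : ∀ {a I b} → Segment a I b → Segment b (reverse I) a
  Segment-reverse {I = I} (ear , short) = StrictEar-reverse ear , subst (_≤ p ∸ 2) (≡.sym (length-reverse I)) short

  Branch : Fin n → Set
  Branch v = v ∈ S × δ v ≢ 2

  branch? : ∀ v → Dec (Branch v)
  branch? v = v ∈? S ×-dec ¬? (δ v ℕ.≟ 2)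

  module FromThreads (minDeg2 : ∀ v → v ∈ S → 2 ≤ δ v) (threads : Threads) where

    endpoint : Fin n → Fin n → Fin n
    endpoint a x with a ∈? S | x ∈? nbrIn G S a
    ... | yes a∈S | yes x∈N = Thread.end (threads a x a∈S x∈N)
    ... | _       | _       = a  -- junk: x is not a neighbour of a in G[S]

    thread-to-endpoint : ∀ {a x} → a ∈ S → x ∈ nbrIn G S a → Σ (Thread a x) λ t → Thread.end t ≡ endpoint a x
    thread-to-endpoint {a} {x} a∈S x∈N with a ∈? S | x ∈? nbrIn G S a
    ... | yes a∈S′ | yes x∈N′ = threads a x a∈S′ x∈N′ , refl
    ... | no a∉S   | _        = ⊥-elim (a∉S a∈S)
    ... | yes _    | no x∉N   = ⊥-elim (x∉N x∈N)

    endpoint-branch : ∀ {a x} → a ∈ S → x ∈ nbrIn G S a → Branch (endpoint a x)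
    endpoint-branch a∈S x∈N with thread-to-endpoint a∈S x∈N
    ... | t , refl = proj₁ (proj₂ (Thread.ear t)) , Thread.end≢2 t

    endpoints-distinct : ∀ {a x x′} → a ∈ S → x ∈ nbrIn G S a → x′ ∈ nbrIn G S a → x ≢ x′ →
                         endpoint a x ≢ endpoint a x′
    endpoints-distinct a∈S x∈N x′∈N x≢x′ with thread-to-endpoint a∈S x∈N | thread-to-endpoint a∈S x′∈N
    ... | t , refl | t′ , refl = thread-ends-distinct t t′ x≢x′

    Linked : Fin n → Fin n → Set
    Linked a b = a ∈ S × ∃ λ x → x ∈ nbrIn G S a × endpoint a x ≡ b

    linked? : ∀ a b → Dec (Linked a b)
    linked? a b = a ∈? S ×-dec Fin.any? λ x → x ∈? nbrIn G S a ×-dec endpoint a x ≟ b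

    linked⇒segment : ∀ {a b} → Linked a b → ∃ λ I → Segment a I b
    linked⇒segment (a∈S , x , x∈N , refl) with thread-to-endpoint a∈S x∈N
    ... | t , refl = Thread.interior t , Thread.ear t , Thread.short t

    ¬linked-to-self : ∀ {a} → ¬ Linked a a
    ¬linked-to-self link with linked⇒segment link
    ... | _ , ear , _ = StrictEar-ends-distinct ear refl

    -- opaque: unfolding φ i into the filtered enumeration makes conversion checking blow up
    opaque
      branches : List (Fin n)
      branches = filter branch? (allFin n)

      m : ℕ
      m = length branches

      φ : Fin m → Fin n
      φ = lookup branches

      φ-injective : ∀ i j → φ i ≡ φ j → i ≡ j
      φ-injective = Unique⇒lookup-injective (Unique.filter⁺ branch? (Unique.allFin⁺ n))

      φ-branch : ∀ i → Branch (φ i)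
      φ-branch i = proj₂ (∈-filter⁻ branch? {xs = allFin n} (∈-lookup i))

      index : ∀ {v} → Branch v → Fin m
      index {v} br = Any.index (∈-filter⁺ branch? (∈-allFin v) br)

      φ-index : ∀ {v} (br : Branch v) → φ (index br) ≡ v
      φ-index {v} br = ≡.sym (Any.lookup-index (∈-filter⁺ branch? (∈-allFin v) br))

    linked : Fin n → Fin n → Bool
    linked a b = does (linked? a b)

    F : Graph m
    F = record
      { adj    = λ i j → linked (φ i) (φ j) ∨ linked (φ j) (φ i)
      ; sym    = λ i j → ∨-comm (linked (φ i) (φ j)) (linked (φ j) (φ i))
      ; irrefl = λ i → cong₂ _∨_ (dec-false (linked? (φ i) (φ i)) ¬linked-to-self)
                                 (dec-false (linked? (φ i) (φ i)) ¬linked-to-self)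
      }

    between : ∀ {a b} → Dec (Linked a b) → Dec (Linked b a) → List (Fin n)
    between (yes ab) _        = proj₁ (linked⇒segment ab)
    between (no _)   (yes ba) = reverse (proj₁ (linked⇒segment ba))
    between (no _)   (no _)   = []

    between-segment : ∀ {a b} (ab? : Dec (Linked a b)) (ba? : Dec (Linked b a)) →
                      does ab? ∨ does ba? ≡ true → Segment a (between ab? ba?) b
    between-segment (yes ab) _        _ = proj₂ (linked⇒segment ab)
    between-segment (no _)   (yes ba) _ = Segment-reverse (proj₂ (linked⇒segment ba))

    int : Fin m → Fin m → List (Fin n)
    int i j = between (linked? (φ i) (φ j)) (linked? (φ j) (φ i))

    segment : ∀ i j → Adj F i j → Segment (φ i) (int i j) (φ j)
    segment i j = between-segment (linked? (φ i) (φ j)) (linked? (φ j) (φ i))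

    minDeg3 : ∀ i → 3 ≤ deg F i
    minDeg3 i with φ-branch i
    ... | a∈S , a≢2 with 3≤∣p∣⇒∃-three-distinct (nbrIn G S (φ i)) (≤∧≢⇒< (minDeg2 _ a∈S) (a≢2 ∘ ≡.sym))
    ... | x₁ , x₂ , x₃ , x₁∈ , x₂∈ , x₃∈ , (x₁≢x₂ ∷ x₁≢x₃ ∷ []) ∷ (x₂≢x₃ ∷ []) ∷ [] ∷ [] =
      Unique⇒length≤∣p∣ ((apart x₁∈ x₂∈ x₁≢x₂ ∷ apart x₁∈ x₃∈ x₁≢x₃ ∷ []) ∷ (apart x₂∈ x₃∈ x₂≢x₃ ∷ []) ∷ [] ∷ [])
                 (towards x₁∈ ∷ towards x₂∈ ∷ towards x₃∈ ∷ [])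
      where
      j : ∀ {x} → x ∈ nbrIn G S (φ i) → Fin m
      j x∈ = index (endpoint-branch a∈S x∈)
      towards : ∀ {x} (x∈ : x ∈ nbrIn G S (φ i)) → j x∈ ∈ nbrIn F ⊤ i
      towards x∈ = ∈nbrIn⁺ {G = F} ∈⊤
        (cong (_∨ linked (φ (j x∈)) (φ i))
              (dec-true (linked? (φ i) (φ (j x∈))) (a∈S , _ , x∈ , ≡.sym (φ-index (endpoint-branch a∈S x∈)))))
      apart : ∀ {x x′} (x∈ : x ∈ nbrIn G S (φ i)) (x′∈ : x′ ∈ nbrIn G S (φ i)) → x ≢ x′ → j x∈ ≢ j x′∈
      apart x∈ x′∈ x≢x′ j≡j′ =
        endpoints-distinct a∈S x∈ x′∈ x≢x′
          (trans (≡.sym (φ-index (endpoint-branch a∈S x∈))) (trans (cong φ j≡j′) (φ-index (endpoint-branch a∈S x′∈))))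

    segments-disjoint : ∀ i j i′ j′ → i <ᶠ j → Adj F i j → i′ <ᶠ j′ → Adj F i′ j′ → (i , j) ≢ (i′ , j′) →
                        ∀ x → x ∈ˡ int i j → ¬ (x ∈ˡ int i′ j′)
    segments-disjoint i j i′ j′ i<j i~j i′<j′ i′~j′ ij≢i′j′ x x∈ x∈′
      with ears-sharing-interior (proj₁ (segment i j i~j)) (proj₁ (segment i′ j′ i′~j′))
             (proj₂ (φ-branch i)) (proj₂ (φ-branch j)) (proj₂ (φ-branch i′)) (proj₂ (φ-branch j′)) x∈ x∈′
    ... | i-end , j-end =
      ij≢i′j′ (same-ends⇒same-pair i<j i′<j′ (Sum.map (φ-injective _ _) (φ-injective _ _) i-end)
                                             (Sum.map (φ-injective _ _) (φ-injective _ _) j-end))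

    subdivision : SubdivisionIn (p ∸ 2) F G
    subdivision = record
      { φ      = φ
      ; φ-inj  = φ-injective
      ; int    = int
      ; short  = λ i j _ i~j → proj₂ (segment i j i~j)
      ; path   = λ i j _ i~j → let (_ , _ , _ , _ , walk , _) , _ = segment i j i~j in walk
      ; uniq   = λ i j _ i~j → StrictEar-interior-unique (proj₁ (segment i j i~j))
      ; avoid  = λ i j _ i~j x x∈ w φw≡x → let (_ , _ , _ , _ , _ , I²) , _ = segment i j i~j in
                   proj₂ (φ-branch w) (trans (cong δ φw≡x) (All.lookup I² x∈))
      ; disj   = segments-disjoint
      }

    some-branch : Nonempty S → Fin m
    some-branch (v , v∈S) with length<∣p∣⇒∃∉ (nbrIn G S v) [] (≤-trans (s≤s z≤n) (minDeg2 v v∈S))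
    ... | x , x∈N , _ = index (endpoint-branch v∈S x∈N)

  remove-low-degree : ∀ {v} → v ∈ S → δ v ≤ 1 → Reduction p G S (S - v)
  remove-low-degree {v} v∈S δv≤1 with δ v in δv≡ | δv≤1
  ... | zero        | _         = delIsolated v v∈S δv≡
  ... | suc zero    | _         = delLeaf v v∈S δv≡
  ... | suc (suc _) | s≤s ()

  Shrinks : Set
  Shrinks = ∃ λ S′ → Reduction p G S S′ × ∣ S′ ∣ < ∣ S ∣

  long-ear-shrinks : LongEar → Shrinks
  long-ear-shrinks (a , [] , b , _ , p≤1) = ⊥-elim (<⇒≱ 2≤p p≤1)
  long-ear-shrinks (a , y ∷ ys , b , ear@(_ , _ , y∈S ∷ _ , _) , p≤) =
    removeAll S (y ∷ ys) , delEar a (y ∷ ys) b ear p≤ , ∣removeAll∣<∣p∣ ys y∈S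

  shrinks-or-subdivision : Nonempty S → Shrinks ⊎ ContainsSubdivMinDeg3 (p ∸ 2) G
  shrinks-or-subdivision nonempty with some⊎all low-degree?
    where
    low-degree? : ∀ v → (v ∈ S × δ v ≤ 1) ⊎ (v ∈ S → 2 ≤ δ v)
    low-degree? v with v ∈? S | δ v ℕ.≤? 1
    ... | yes v∈S | yes δv≤1 = inj₁ (v∈S , δv≤1)
    ... | yes _   | no δv≰1  = inj₂ λ _ → ≰⇒> δv≰1
    ... | no v∉S  | _        = inj₂ λ v∈S → ⊥-elim (v∉S v∈S)
  ... | inj₁ (v , v∈S , δv≤1) = inj₁ (S - v , remove-low-degree v∈S δv≤1 , x∈p⇒∣p-x∣<∣p∣ v∈S)
  ... | inj₂ minDeg2 with long-ear-or-threads
  ...   | inj₁ ear     = inj₁ (long-ear-shrinks ear)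
  ...   | inj₂ threads =
    inj₂ (m , F , ℕ.>-nonZero⁻¹ m ⦃ Fin.nonZeroIndex (some-branch nonempty) ⦄ , minDeg3 , subdivision)
    where open FromThreads minDeg2 threads

no-subdivision⇒path-degenerate : ∀ {n p} {G : Graph n} → 2 ≤ p → GirthAtLeast G (2 * p ∸ 1) →
                                 ¬ ContainsSubdivMinDeg3 (p ∸ 2) G → PathDegenerate p G
no-subdivision⇒path-degenerate {n} {p} {G} 2≤p girth no-subdivision = reduce n ⊤ (∣p∣≤n ⊤)
  where
  reduce : ∀ k S → ∣ S ∣ ≤ k → Reducible p G S
  reduce k S ∣S∣≤k with nonempty? S
  ... | no empty = subst (Reducible p G) (≡.sym (Empty-unique empty)) done
  ... | yes nonempty with Backward.shrinks-or-subdivision 2≤p girth S nonempty | k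
  ...   | inj₂ subdivision         | _    = ⊥-elim (no-subdivision subdivision)
  ...   | inj₁ (S′ , red , ∣S′∣<∣S∣) | zero = ⊥-elim (<⇒≱ ∣S′∣<∣S∣ (≤-trans ∣S∣≤k z≤n))
  ...   | inj₁ (S′ , red , ∣S′∣<∣S∣) | suc k′ = step red (reduce k′ S′ (≤-pred (≤-trans ∣S′∣<∣S∣ ∣S∣≤k)))

mainTheorem9 : (p n : ℕ) (G : Graph n) → 2 ≤ p → GirthAtLeast G (2 * p ∸ 1) →
    (PathDegenerate p G ⇔ (¬ ContainsSubdivMinDeg3 (p ∸ 2) G))
mainTheorem9 p n G 2≤p girth =
  mk⇔ (path-degenerate⇒no-subdivision (suc<p 2≤p ≤-refl)) (no-subdivision⇒path-degenerate 2≤p girth)
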